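{- Let $\mathcal{S}=\langle\mathcal{L},\vdash\rangle$ be a monotonic logic with $\mathcal{L}$ infinite. If $\mathcal{S}$ is finitely trivializable, then sECQ holds in $\mathcal{S}$.
   Context: A logic is a pair $\langle\mathcal{L},\vdash\rangle$ with $\mathcal{L}$ a set and $\vdash\,\subseteq\mathcal{P}(\mathcal{L})\times\mathcal{L}$; $C_\vdash(\Gamma)=\{\alpha:\Gamma\vdash\alpha\}$. Monotonic: $\Gamma\subseteq\Sigma$ implies $C_\vdash(\Gamma)\subseteq C_\vdash(\Sigma)$. $\mathcal{S}$ is finitely trivializable if there is a finite $\Gamma\subseteq\mathcal{L}$ with $C_\vdash(\Gamma)=\mathcal{L}$. sECQ: for each $\alpha\in\mathcal{L}$ there is $\Gamma\subsetneq\mathcal{L}$ with $\alpha\in\Gamma$ and $C_\vdash(\Gamma)=\mathcal{L}$. -}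

module Defs where

open import Level using (0ℓ)
open import Data.Nat using (ℕ)
open import Data.Fin using (Fin)
open import Data.List using (List)
open import Data.List.Membership.Propositional using (_∈_)
open import Data.Product using (Σ; ∃; _×_)
open import Relation.Nullary using (¬_)
open import Relation.Unary using (Pred; _⊆_)
open import Function.Bundles using (_↔_; _⇔_)

record Logic : Set₁ where
  field
    Form : Set
    _⊢_  : Pred Form 0ℓ → Form → Set

open Logic public

C : (S : Logic) → Pred (Form S) 0ℓ → Pred (Form S) 0ℓ
C S Γ α = _⊢_ S Γ α

_≐_ : {A : Set} → Pred A 0ℓ → Pred A 0ℓ → Set
P ≐ Q = (P ⊆ Q) × (Q ⊆ P)

Whole : (A : Set) → Pred A 0ℓ
Whole A _ = Data.Unit.⊤
  where import Data.Unit

ProperSubset : {A : Set} → Pred A 0ℓ → Set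
ProperSubset {A} Γ = (Γ ⊆ Whole A) × ¬ (Γ ≐ Whole A)

Monotonic : Logic → Set₁
Monotonic S = ∀ (Γ Σ' : Pred (Form S) 0ℓ) → Γ ⊆ Σ' → C S Γ ⊆ C S Σ'

FiniteSet : Set → Set
FiniteSet A = Σ ℕ (λ n → A ↔ Fin n)

InfiniteSet : Set → Set
InfiniteSet A = ¬ FiniteSet A

FiniteSubset : {A : Set} → Pred A 0ℓ → Set
FiniteSubset {A} Γ = Σ (List A) (λ xs → ∀ x → (Γ x ⇔ x ∈ xs))

FinitelyTrivializable : Logic → Set₁
FinitelyTrivializable S =
  Σ (Pred (Form S) 0ℓ) (λ Γ → FiniteSubset Γ × (C S Γ ≐ Whole (Form S)))

sECQ : Logic → Set₁
sECQ S = ∀ (α : Form S) → Σ (Pred (Form S) 0ℓ) (λ Γ →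
           ProperSubset Γ × Γ α × (C S Γ ≐ Whole (Form S)))

{-# OPTIONS --safe #-}
module Submission where

-- If the finite set Γ trivializes S, then by monotonicity so does Γ ∪ {α}
-- for every formula α.  This set is still finite, and a finite subset of an
-- infinite set is proper: were it everything, a list would enumerate 𝓛.
-- Since equality on 𝓛 is not assumed decidable, we only get that it is
-- ¬¬-decidable on the finitely many listed formulas; that suffices, because
-- the goal is a negation.

open import Defs
open import Data.Nat as ℕ using ()
open import Data.Fin using (Fin; zero; suc)
open import Data.Fin.Properties using (∀-cons)
open import Data.List using (List; _∷_; lookup; length; deduplicate)
open import Data.List.Membership.Propositional using (_∈_)
open import Data.List.Membership.Propositional.Properties using (∈-lookup)
open import Data.List.Relation.Unary.All as All using ()
open import Data.List.Relation.Unary.Any using (here; there; index)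
open import Data.List.Relation.Unary.Any.Properties using (lookup-index)
open import Data.List.Relation.Unary.Enumerates.Setoid.Properties
  using (deduplicate⁺; lookup-surjective)
open import Data.List.Relation.Unary.Unique.Propositional using (Unique; _∷_)
open import Data.List.Relation.Unary.Unique.DecPropositional.Properties
  using (deduplicate-!)
open import Data.Product using (_,_)
open import Data.Sum using (inj₁; inj₂; [_,_])
open import Data.Unit using (tt)
open import Function using (_∘_)
open import Function.Bundles using (mk⤖; mk⇔; Equivalence)
open import Function.Definitions using (Injective; Surjective)
open import Function.Properties.Bijection using (⤖⇒↔)
open import Function.Properties.Inverse using (↔-sym)
open import Relation.Binary.Definitions using (DecidableEquality)
open import Relation.Binary.PropositionalEquality
  using (_≡_; refl; sym; trans; cong; setoid; decSetoid)
open import Relation.Nullary using (¬_; Dec; contradiction)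
open import Relation.Nullary.Decidable using (map′; ¬¬-excluded-middle)
open import Relation.Unary using (Pred; _⊆_; _∪_; ｛_｝)
open import Level using (0ℓ)

lookup-injective : {A : Set} {xs : List A} → Unique xs → Injective _≡_ _≡_ (lookup xs)
lookup-injective {xs = _ ∷ _} _            {zero}  {zero}  _  = refl
lookup-injective              (x∉xs ∷ _)   {zero}  {suc j} eq = contradiction eq (All.lookup x∉xs (∈-lookup j))
lookup-injective              (x∉xs ∷ _)   {suc i} {zero}  eq = contradiction (sym eq) (All.lookup x∉xs (∈-lookup i))
lookup-injective              (_ ∷ unique) {suc i} {suc j} eq = cong suc (lookup-injective unique eq)

enumeration⇒finite : {A : Set} → DecidableEquality A → (xs : List A) → (∀ x → x ∈ xs) → FiniteSet A
enumeration⇒finite {A} _≟_ xs enumerates = length ys , ↔-sym (⤖⇒↔ (mk⤖ (injective , surjective)))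
  where
  ys : List A
  ys = deduplicate _≟_ xs
  injective : Injective _≡_ _≡_ (lookup ys)
  injective = lookup-injective (deduplicate-! _≟_ xs)
  surjective : Surjective _≡_ _≡_ (lookup ys)
  surjective = lookup-surjective (setoid A) (deduplicate⁺ (decSetoid _≟_) enumerates)

enumeration⇒decidableEquality : {A : Set} (xs : List A) → (∀ x → x ∈ xs) →
  (∀ i j → Dec (lookup xs i ≡ lookup xs j)) → DecidableEquality A
enumeration⇒decidableEquality xs enumerates _≟ᵢ_ x y =
  map′ (λ e → trans x≡xᵢ (trans e (sym y≡yᵢ))) (λ e → trans (sym x≡xᵢ) (trans e y≡yᵢ))
       (index (enumerates x) ≟ᵢ index (enumerates y))
  where
  x≡xᵢ : x ≡ lookup xs (index (enumerates x))
  x≡xᵢ = lookup-index (enumerates x)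
  y≡yᵢ : y ≡ lookup xs (index (enumerates y))
  y≡yᵢ = lookup-index (enumerates y)

¬¬-∀-Fin : ∀ {n} {P : Fin n → Set} → (∀ i → ¬ ¬ P i) → ¬ ¬ (∀ i → P i)
¬¬-∀-Fin {ℕ.zero}  _ k = k λ ()
¬¬-∀-Fin {ℕ.suc n} h k = h zero λ p₀ → ¬¬-∀-Fin (h ∘ suc) λ ps → k (∀-cons p₀ ps)

infinite⇒¬enumeration : {A : Set} → InfiniteSet A → (xs : List A) → ¬ (∀ x → x ∈ xs)
infinite⇒¬enumeration infinite xs enumerates =
  ¬¬-∀-Fin (λ _ → ¬¬-∀-Fin (λ _ → ¬¬-excluded-middle)) λ _≟ᵢ_ →
    infinite (enumeration⇒finite (enumeration⇒decidableEquality xs enumerates _≟ᵢ_) xs enumerates)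

infinite⇒finiteSubset-proper : {A : Set} {Γ : Pred A 0ℓ} → InfiniteSet A → FiniteSubset Γ → ProperSubset Γ
infinite⇒finiteSubset-proper infinite (xs , Γ⇔xs) =
  (λ _ → tt) , λ (_ , whole⊆Γ) → infinite⇒¬enumeration infinite xs (λ x → Equivalence.to (Γ⇔xs x) (whole⊆Γ tt))

finiteSubset-∪-singleton : {A : Set} {Γ : Pred A 0ℓ} (α : A) → FiniteSubset Γ → FiniteSubset (Γ ∪ ｛ α ｝)
finiteSubset-∪-singleton α (xs , Γ⇔xs) = α ∷ xs , λ x → mk⇔
  [ there ∘ Equivalence.to (Γ⇔xs x) , here ∘ sym ]
  λ { (here x≡α) → inj₂ (sym x≡α) ; (there x∈xs) → inj₁ (Equivalence.from (Γ⇔xs x) x∈xs) }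

trivializing-mono : (S : Logic) → Monotonic S → {Γ Δ : Pred (Form S) 0ℓ} → Γ ⊆ Δ →
  C S Γ ≐ Whole (Form S) → C S Δ ≐ Whole (Form S)
trivializing-mono S mono {Γ} {Δ} Γ⊆Δ (_ , whole⊆CΓ) =
  (λ _ → tt) , λ _ → mono Γ Δ Γ⊆Δ (whole⊆CΓ tt)

theorem3p29 : (S : Logic) → Monotonic S → InfiniteSet (Form S)
    → FinitelyTrivializable S → sECQ S
theorem3p29 S mono infinite (Γ , finite , trivializes) α =
  Γ ∪ ｛ α ｝ ,
  infinite⇒finiteSubset-proper infinite (finiteSubset-∪-singleton α finite) ,
  inj₂ refl ,
  trivializing-mono S mono inj₁ trivializes
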